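{- Let $G$ be a finite group and $I$ a set, and let $H$ be a subgroup of $G^I$ which is definable with parameters in the Boolean algebra $\mathcal P(I)$ (via the interpretation of $G^I$ in $\mathcal P(I)$ described in the context). Then $H$ is closed in $G^I$ with respect to the product topology ($G$ discrete).
   Context: Interpretation of $G^I$ in $B=\mathcal P(I)$: choose $m$ with $2^m\ge|G|$ and a surjective listing $c_1,\dots,c_{2^m}$ of $G$ (repetitions allowed) indexed by $\{0,1\}^m$; then $B^m=(2^I)^m=(\{0,1\}^m)^I$ maps onto $G^I$ coordinatewise, and the induced equivalence relation and group operation are definable in the Boolean algebra. A subset of $G^I$ is definable in $\mathcal P(I)$ if its preimage in $B^m$ is definable with parameters in the Boolean algebra $(\mathcal P(I),\cup,\cap,\text{complement},\emptyset,I)$. -}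

module Defs where

open import Level using (0ℓ)
open import Data.Nat using (ℕ; suc; _+_)
open import Data.Fin using (Fin; zero; suc)
open import Data.Bool using (Bool; true; false; not; _∧_; _∨_)
open import Data.Vec using (Vec; tabulate)
open import Data.Vec.Functional using (_++_)
open import Data.List using (List)
open import Data.List.Membership.Propositional using (_∈_)
open import Data.Product using (Σ; _×_; ∃)
open import Data.Sum using (_⊎_)
open import Data.Empty using (⊥)
open import Data.Unit using (⊤)
open import Relation.Nullary using (¬_)
open import Relation.Binary.PropositionalEquality using (_≡_)
open import Algebra.Bundles using (Group)

Subset : Set → Set
Subset I = I → Bool

data Term (n : ℕ) : Set where
  var  : Fin n → Term n
  bot  : Term n
  top  : Term n
  _∪ₜ_ : Term n → Term n → Term n
  _∩ₜ_ : Term n → Term n → Term n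
  compl : Term n → Term n

data Formula : ℕ → Set where
  _≐_   : ∀ {n} → Term n → Term n → Formula n
  falsum : ∀ {n} → Formula n
  ¬ᶠ_   : ∀ {n} → Formula n → Formula n
  _∧ᶠ_  : ∀ {n} → Formula n → Formula n → Formula n
  _∨ᶠ_  : ∀ {n} → Formula n → Formula n → Formula n
  _⇒ᶠ_  : ∀ {n} → Formula n → Formula n → Formula n
  ∀ᶠ    : ∀ {n} → Formula (suc n) → Formula n
  ∃ᶠ    : ∀ {n} → Formula (suc n) → Formula n

extend : ∀ {I : Set} {n} → Subset I → (Fin n → Subset I) → Fin (suc n) → Subset I
extend a ρ zero    = a
extend a ρ (suc k) = ρ k

⟦_⟧ₜ : ∀ {I : Set} {n} → Term n → (Fin n → Subset I) → Subset I
⟦ var k ⟧ₜ ρ = ρ k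
⟦ bot ⟧ₜ ρ = λ _ → false
⟦ top ⟧ₜ ρ = λ _ → true
⟦ s ∪ₜ t ⟧ₜ ρ = λ i → ⟦ s ⟧ₜ ρ i ∨ ⟦ t ⟧ₜ ρ i
⟦ s ∩ₜ t ⟧ₜ ρ = λ i → ⟦ s ⟧ₜ ρ i ∧ ⟦ t ⟧ₜ ρ i
⟦ compl t ⟧ₜ ρ = λ i → not (⟦ t ⟧ₜ ρ i)

Sat : ∀ (I : Set) {n} → Formula n → (Fin n → Subset I) → Set
Sat I (s ≐ t) ρ = ∀ i → ⟦ s ⟧ₜ ρ i ≡ ⟦ t ⟧ₜ ρ i
Sat I falsum ρ = ⊥
Sat I (¬ᶠ φ) ρ = ¬ Sat I φ ρ
Sat I (φ ∧ᶠ ψ) ρ = Sat I φ ρ × Sat I ψ ρ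
Sat I (φ ∨ᶠ ψ) ρ = Sat I φ ρ ⊎ Sat I ψ ρ
Sat I (φ ⇒ᶠ ψ) ρ = Sat I φ ρ → Sat I ψ ρ
Sat I (∀ᶠ φ) ρ = (a : Subset I) → Sat I φ (extend a ρ)
Sat I (∃ᶠ φ) ρ = Σ (Subset I) λ a → Sat I φ (extend a ρ)

module _ (G : Group 0ℓ 0ℓ) where
  open Group G

  SurjectiveListing : (m : ℕ) → (Vec Bool m → Carrier) → Set
  SurjectiveListing m c = ∀ g → Σ (Vec Bool m) λ v → c v ≈ g

  -- The coordinatewise map B^m = (2^I)^m = ({0,1}^m)^I → G^I.
  decode : ∀ {I : Set} (m : ℕ) → (Vec Bool m → Carrier) →
           (Fin m → Subset I) → (I → Carrier)
  decode m c x i = c (tabulate λ k → x k i)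

  -- H ⊆ G^I is definable with parameters in P(I) (via the listing c):
  -- its preimage in B^m is defined by a formula φ with m free
  -- variables plus k parameter variables, instantiated by parameters p.
  DefinableWithParams : (I : Set) (m : ℕ) (c : Vec Bool m → Carrier) →
                        ((I → Carrier) → Set) → Set
  DefinableWithParams I m c H =
    Σ ℕ λ k → Σ (Formula (m + k)) λ φ → Σ (Fin k → Subset I) λ p →
      ∀ (x : Fin m → Subset I) →
        (H (decode m c x) → Sat I φ (x ++ p)) × (Sat I φ (x ++ p) → H (decode m c x))

  IsSubgroupᴵ : (I : Set) → ((I → Carrier) → Set) → Set
  IsSubgroupᴵ I H =
    (∀ g h → (∀ i → g i ≈ h i) → H g → H h) ×
    (H (λ _ → ε)) ×
    (∀ g h → H g → H h → H (λ i → g i ∙ h i)) ×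
    (∀ g → H g → H (λ i → g i ⁻¹))

  -- H is closed in G^I for the product topology, G discrete: every g all
  -- of whose basic neighbourhoods {h | h agrees with g on finite F} meet H
  -- belongs to H.
  ClosedInProduct : (I : Set) → ((I → Carrier) → Set) → Set
  ClosedInProduct I H =
    ∀ (g : I → Carrier) →
      (∀ (F : List I) → Σ (I → Carrier) λ h → H h × (∀ i → i ∈ F → h i ≈ g i)) →
      H g

{-# OPTIONS --safe #-}
module Submission where

-- A tuple of subsets of I splits I into cells (the atoms of the Boolean algebra it generates), and
-- whether it satisfies a formula φ depends only on the sizes of these cells truncated at a threshold
-- T(φ), since a new subset can be matched cell by cell (back-and-forth).
-- Codes of elements of G^I are such tuples. Among codes of elements of H take one, z, whose truncated
-- cell sizes are maximal; they are bounded, so z exists, and they are witnessed on a finite F ⊆ I.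
-- If g is adherent to H, choose h ∈ H agreeing with g on F: y = (dec z · h⁻¹) · g is adherent to H and
-- agrees with dec z on F, so it has a code z_y whose cell sizes dominate those of z. Approximating y
-- on the witnesses of z_y by an element of H, maximality of z forces z_y and z to have the same
-- truncated cell sizes, so z_y satisfies φ: y ∈ H, hence g ∈ H.

open import Defs
open import Level using (0ℓ)
open import Function using (_∘_)
open import Function.Definitions using (Injective)
open import Data.Nat using (ℕ; zero; suc; _+_; _⊔_; _≤_; _<_; s≤s⁻¹; _<?_)
open import Data.Nat.Properties
open import Data.Fin using (Fin; zero; suc; splitAt)
open import Data.Fin.Properties using (injective⇒≤)
open import Data.Bool using (Bool; true; false; not; _∧_; _∨_; if_then_else_)
open import Data.Bool.Properties using (not-injective)
open import Data.Vec using (Vec; []; _∷_; tabulate; lookup)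
open import Data.Vec.Properties using (tabulate-cong; tabulate∘lookup; lookup∘tabulate; ∷-injective)
import Data.Vec.Functional as Vector
open import Data.List as List using (List; []; _∷_; length; _++_)
open import Data.List.Properties using (length-++; length-take)
open import Data.List.Membership.Propositional using (_∈_; _∉_)
open import Data.List.Membership.Propositional.Properties
  using (∈-++⁺ˡ; ∈-++⁺ʳ; ∈-++⁻; ∈-lookup)
open import Data.List.Relation.Unary.Any using (here; there; index)
open import Data.List.Relation.Unary.Any.Properties using (lookup-index)
open import Data.List.Relation.Unary.All as All using (All; []; _∷_)
import Data.List.Relation.Unary.All.Properties as All
open import Data.List.Relation.Unary.AllPairs using ([]; _∷_)
open import Data.List.Relation.Unary.Unique.Propositional using (Unique)
import Data.List.Relation.Unary.Unique.Propositional.Properties as Unique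
open import Data.List.Relation.Binary.Disjoint.Propositional using (Disjoint)
open import Data.Product using (Σ; ∃; _×_; _,_; proj₁; proj₂; swap)
open import Data.Sum using (_⊎_; inj₁; inj₂; [_,_]′)
open import Relation.Nullary using (¬_; Dec; yes; no; does; contradiction)
open import Relation.Nullary.Decidable using (dec-true; dec-false; decidable-stable)
open import Relation.Unary using (_⊆_; _∩_; _∪_) renaming (_≐_ to _≐′_)
open import Relation.Unary.Properties using (≐-trans)
open import Relation.Binary.PropositionalEquality
  using (_≡_; refl; sym; trans; cong; cong₂; module ≡-Reasoning)
open import Algebra.Bundles using (Group)
import Algebra.Properties.Group as GroupProperties
open import Axiom.ExcludedMiddle using (ExcludedMiddle)

-- Counting up to a threshold

module _ {I : Set} where

  private
    variable
      A B A′ B′ : I → Set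
      k n s t T : ℕ
      l m : List I

  AtLeast : (I → Set) → ℕ → Set
  AtLeast A k = Σ (List I) λ l → length l ≡ k × Unique l × All A l

  AtLeast-map : A ⊆ B → AtLeast A k → AtLeast B k
  AtLeast-map A⊆B (l , |l| , u , al) = l , |l| , u , All.map A⊆B al

  AtLeast-≤ : k ≤ n → AtLeast A n → AtLeast A k
  AtLeast-≤ {k} k≤n (l , refl , u , al) =
    List.take k l , trans (length-take k l) (m≤n⇒m⊓n≡m k≤n) , Unique.take⁺ k u , All.take⁺ k al

  AtLeast-within : (w : AtLeast A k) → (∀ {x} → x ∈ proj₁ w → A x → B x) → AtLeast B k
  AtLeast-within (l , |l| , u , al) A⇒B =
    l , |l| , u , All.tabulate λ x∈l → A⇒B x∈l (All.lookup al x∈l)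

  AtLeast-zero : AtLeast A 0
  AtLeast-zero = [] , refl , [] , []

  AtLeast-one : ∀ {x} → A x → AtLeast A 1
  AtLeast-one ax = _ ∷ [] , refl , [] ∷ [] , ax ∷ []

  AtLeast-suc⇒∃ : AtLeast A (suc k) → ∃ A
  AtLeast-suc⇒∃ (x ∷ _ , _ , _ , ax ∷ _) = x , ax

  lookup-injective : Unique l → Injective _≡_ _≡_ (List.lookup l)
  lookup-injective (_ ∷ _) {zero} {zero} _ = refl
  lookup-injective (x∉l ∷ _) {zero} {suc j} eq = contradiction eq (All.lookup x∉l (∈-lookup j))
  lookup-injective (x∉l ∷ _) {suc i} {zero} eq = contradiction (sym eq) (All.lookup x∉l (∈-lookup i))
  lookup-injective (_ ∷ u) {suc i} {suc j} eq = cong suc (lookup-injective u eq)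

  Unique-length-mono : Unique l → All (_∈ m) l → length l ≤ length m
  Unique-length-mono {l} {m} u l⊆m = injective⇒≤ position-injective
    where
    position : Fin (length l) → Fin (length m)
    position i = index (All.lookup l⊆m (∈-lookup i))

    position-injective : Injective _≡_ _≡_ position
    position-injective {i} {j} eq = lookup-injective u (begin
      List.lookup l i             ≡⟨ lookup-index (All.lookup l⊆m (∈-lookup i)) ⟩
      List.lookup m (position i)  ≡⟨ cong (List.lookup m) eq ⟩
      List.lookup m (position j)  ≡⟨ lookup-index (All.lookup l⊆m (∈-lookup j)) ⟨
      List.lookup l j             ∎)
      where open ≡-Reasoning

  AtLeast⇒≤length : A ⊆ (_∈ m) → AtLeast A k → k ≤ length m
  AtLeast⇒≤length A⊆m (l , refl , u , al) = Unique-length-mono u (All.map A⊆m al)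

  Unique-++⁻ : ∀ l → Unique (l ++ m) → Unique l × Unique m × Disjoint l m
  Unique-++⁻ [] u = [] , u , λ ()
  Unique-++⁻ (x ∷ l) (x∉ ∷ u) with Unique-++⁻ l u
  ... | ul , um , l#m = All.++⁻ˡ l x∉ ∷ ul , um , disjoint
    where
    disjoint : Disjoint (x ∷ l) _
    disjoint (here refl , y∈m) = All.lookup x∉ (∈-++⁺ʳ l y∈m) refl
    disjoint (there y∈l , y∈m) = l#m (y∈l , y∈m)

  split-++ : ∀ s (l : List I) → length l ≡ s + t →
             Σ (List I) λ p → Σ (List I) λ q → p ++ q ≡ l × length p ≡ s × length q ≡ t
  split-++ zero l |l| = [] , l , refl , refl , |l|
  split-++ (suc s) (x ∷ l) |l| with split-++ s l (suc-injective |l|)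
  ... | p , q , refl , |p| , |q| = x ∷ p , q , refl , cong suc |p| , |q|

  CountLe : ℕ → (I → Set) → (I → Set) → Set
  CountLe T A B = ∀ {k} → k ≤ T → AtLeast A k → AtLeast B k

  CountEq : ℕ → (I → Set) → (I → Set) → Set
  CountEq T A B = CountLe T A B × CountLe T B A

  CountLe-resp : A′ ⊆ A → B ⊆ B′ → CountLe T A B → CountLe T A′ B′
  CountLe-resp A′⊆A B⊆B′ le k≤T = AtLeast-map B⊆B′ ∘ le k≤T ∘ AtLeast-map A′⊆A

  CountEq-resp : A ≐′ A′ → B ≐′ B′ → CountEq T A B → CountEq T A′ B′
  CountEq-resp (A⊆A′ , A′⊆A) (B⊆B′ , B′⊆B) (le , ge) =
    CountLe-resp A′⊆A B⊆B′ le , CountLe-resp B′⊆B A⊆A′ ge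

  AtLeast-++ : (∀ {x} → A x → ¬ B x) → AtLeast A s → AtLeast B t → AtLeast (A ∪ B) (s + t)
  AtLeast-++ A#B (l , refl , ul , al) (m , refl , um , bm) =
    l ++ m , length-++ l , Unique.++⁺ ul um l#m , All.++⁺ (All.map inj₁ al) (All.map inj₂ bm)
    where
    l#m : Disjoint l m
    l#m (x∈l , x∈m) = A#B (All.lookup al x∈l) (All.lookup bm x∈m)

  record TruncatedCount (T : ℕ) (A : I → Set) (t : ℕ) : Set where
    field
      bounded : t ≤ T
      witness : AtLeast A t
      maximal : ∀ {k} → k ≤ T → AtLeast A k → k ≤ t

    elements : List I
    elements = proj₁ witness

    length-elements : length elements ≡ t
    length-elements = proj₁ (proj₂ witness)

  open TruncatedCount public

  saturatedCount : AtLeast A T → TruncatedCount T A T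
  saturatedCount w = record { bounded = ≤-refl ; witness = w ; maximal = λ k≤T _ → k≤T }

  exactCount : (w : AtLeast A t) → A ⊆ (_∈ proj₁ w) → t ≤ T → TruncatedCount T A t
  exactCount w@(l , refl , _) A⊆l t≤T =
    record { bounded = t≤T ; witness = w ; maximal = λ _ → AtLeast⇒≤length A⊆l }

  CountLe⇒≤ : TruncatedCount T A s → TruncatedCount T B t → CountLe T A B → s ≤ t
  CountLe⇒≤ a b le = maximal b (bounded a) (le (bounded a) (witness a))

  ≤⇒CountLe : TruncatedCount T A s → TruncatedCount T B t → s ≤ t → CountLe T A B
  ≤⇒CountLe a b s≤t k≤T ak = AtLeast-≤ (≤-trans (maximal a k≤T ak) s≤t) (witness b)

  sameCount⇒CountEq : TruncatedCount T A t → TruncatedCount T B t → CountEq T A B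
  sameCount⇒CountEq a b = ≤⇒CountLe a b ≤-refl , ≤⇒CountLe b a ≤-refl

  CountEq-by-witness : TruncatedCount T A t → (w : AtLeast B t) → B ⊆ (_∈ proj₁ w) ⊎ t ≡ T →
                       CountEq T A B
  CountEq-by-witness a w (inj₁ B⊆w) = sameCount⇒CountEq a (exactCount w B⊆w (bounded a))
  CountEq-by-witness a w (inj₂ refl) = sameCount⇒CountEq a (saturatedCount w)

-- Cells of a tuple of subsets

evalTerm : ∀ {n} → Term n → Vec Bool n → Bool
evalTerm (var j) σ = lookup σ j
evalTerm bot σ = false
evalTerm top σ = true
evalTerm (s ∪ₜ t) σ = evalTerm s σ ∨ evalTerm t σ
evalTerm (s ∩ₜ t) σ = evalTerm s σ ∧ evalTerm t σ
evalTerm (compl t) σ = not (evalTerm t σ)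

-- A quantifier may split every cell in two, hence the doubling.
threshold : ∀ {n} → Formula n → ℕ
threshold (s ≐ t) = 1
threshold falsum = 0
threshold (¬ᶠ φ) = threshold φ
threshold (φ ∧ᶠ ψ) = threshold φ ⊔ threshold ψ
threshold (φ ∨ᶠ ψ) = threshold φ ⊔ threshold ψ
threshold (φ ⇒ᶠ ψ) = threshold φ ⊔ threshold ψ
threshold (∀ᶠ φ) = threshold φ + threshold φ
threshold (∃ᶠ φ) = threshold φ + threshold φ

module _ {I : Set} where

  private
    variable
      T : ℕ

  fibre : Subset I → Bool → I → Set
  fibre a b i = a i ≡ b

  cellOf : ∀ {n} → (Fin n → Subset I) → I → Vec Bool n
  cellOf ρ i = tabulate λ j → ρ j i

  Cell : ∀ {n} → (Fin n → Subset I) → Vec Bool n → I → Set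
  Cell ρ σ i = cellOf ρ i ≡ σ

  Cell-extend : ∀ {n} (a : Subset I) (ρ : Fin n → Subset I) b σ →
                Cell ρ σ ∩ fibre a b ≐′ Cell (extend a ρ) (b ∷ σ)
  Cell-extend a ρ b σ =
    (λ (c , e) → cong₂ _∷_ e c) , λ eq → proj₂ (∷-injective eq) , proj₁ (∷-injective eq)

  EnvLe : ∀ {n} → ℕ → (Fin n → Subset I) → (Fin n → Subset I) → Set
  EnvLe T ρ ρ′ = ∀ σ → CountLe T (Cell ρ σ) (Cell ρ′ σ)

  EnvEq : ∀ {n} → ℕ → (Fin n → Subset I) → (Fin n → Subset I) → Set
  EnvEq T ρ ρ′ = ∀ σ → CountEq T (Cell ρ σ) (Cell ρ′ σ)

  EnvLe-trans : ∀ {n} {ρ₁ ρ₂ ρ₃ : Fin n → Subset I} →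
                EnvLe T ρ₁ ρ₂ → EnvLe T ρ₂ ρ₃ → EnvLe T ρ₁ ρ₃
  EnvLe-trans le₁ le₂ σ k≤T = le₂ σ k≤T ∘ le₁ σ k≤T

  EnvLe-antisym : ∀ {n} {ρ ρ′ : Fin n → Subset I} →
                  EnvLe T ρ ρ′ → EnvLe T ρ′ ρ → EnvEq T ρ ρ′
  EnvLe-antisym le ge σ = le σ , ge σ

  EnvEq-sym : ∀ {n} {ρ ρ′ : Fin n → Subset I} → EnvEq T ρ ρ′ → EnvEq T ρ′ ρ
  EnvEq-sym eq = swap ∘ eq

  EnvEq-≤ : ∀ {n T′} {ρ ρ′ : Fin n → Subset I} → T′ ≤ T → EnvEq T ρ ρ′ → EnvEq T′ ρ ρ′
  EnvEq-≤ T′≤T eq σ =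
    (λ k≤T′ → proj₁ (eq σ) (≤-trans k≤T′ T′≤T)) , (λ k≤T′ → proj₂ (eq σ) (≤-trans k≤T′ T′≤T))

  ⟦⟧ₜ-cellOf : ∀ {n} (t : Term n) (ρ : Fin n → Subset I) i → ⟦ t ⟧ₜ ρ i ≡ evalTerm t (cellOf ρ i)
  ⟦⟧ₜ-cellOf (var j) ρ i = sym (lookup∘tabulate (λ j → ρ j i) j)
  ⟦⟧ₜ-cellOf bot ρ i = refl
  ⟦⟧ₜ-cellOf top ρ i = refl
  ⟦⟧ₜ-cellOf (s ∪ₜ t) ρ i = cong₂ _∨_ (⟦⟧ₜ-cellOf s ρ i) (⟦⟧ₜ-cellOf t ρ i)
  ⟦⟧ₜ-cellOf (s ∩ₜ t) ρ i = cong₂ _∧_ (⟦⟧ₜ-cellOf s ρ i) (⟦⟧ₜ-cellOf t ρ i)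
  ⟦⟧ₜ-cellOf (compl t) ρ i = cong not (⟦⟧ₜ-cellOf t ρ i)

  ⟦⟧ₜ-sameCell : ∀ {n} (t : Term n) {ρ ρ′ : Fin n → Subset I} {i j} →
                 cellOf ρ i ≡ cellOf ρ′ j → ⟦ t ⟧ₜ ρ i ≡ ⟦ t ⟧ₜ ρ′ j
  ⟦⟧ₜ-sameCell t {ρ} {ρ′} {i} {j} same = begin
    ⟦ t ⟧ₜ ρ i                 ≡⟨ ⟦⟧ₜ-cellOf t ρ i ⟩
    evalTerm t (cellOf ρ i)    ≡⟨ cong (evalTerm t) same ⟩
    evalTerm t (cellOf ρ′ j)   ≡⟨ ⟦⟧ₜ-cellOf t ρ′ j ⟨
    ⟦ t ⟧ₜ ρ′ j                ∎
    where open ≡-Reasoning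


sumCells : ∀ N → (Vec Bool N → ℕ) → ℕ
sumCells zero f = f []
sumCells (suc N) f = sumCells N (f ∘ (true ∷_)) + sumCells N (f ∘ (false ∷_))

sumCells-mono : ∀ N {f g : Vec Bool N → ℕ} → (∀ σ → f σ ≤ g σ) → sumCells N f ≤ sumCells N g
sumCells-mono zero f≤g = f≤g []
sumCells-mono (suc N) f≤g =
  +-mono-≤ (sumCells-mono N (f≤g ∘ (true ∷_))) (sumCells-mono N (f≤g ∘ (false ∷_)))

sumCells-strict : ∀ {N} {f g : Vec Bool N → ℕ} → (∀ σ → f σ ≤ g σ) → ∀ σ → f σ < g σ →
                  sumCells N f < sumCells N g
sumCells-strict f≤g [] f<g = f<g
sumCells-strict {suc N} f≤g (true ∷ σ) f<g =
  +-mono-<-≤ (sumCells-strict (f≤g ∘ (true ∷_)) σ f<g) (sumCells-mono N (f≤g ∘ (false ∷_)))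
sumCells-strict {suc N} f≤g (false ∷ σ) f<g =
  +-mono-≤-< (sumCells-mono N (f≤g ∘ (true ∷_))) (sumCells-strict (f≤g ∘ (false ∷_)) σ f<g)

concatCells : ∀ {A : Set} N → (Vec Bool N → List A) → List A
concatCells zero f = f []
concatCells (suc N) f = concatCells N (f ∘ (true ∷_)) ++ concatCells N (f ∘ (false ∷_))

∈-concatCells : ∀ {A : Set} {N} (f : Vec Bool N → List A) σ {x} → x ∈ f σ → x ∈ concatCells N f
∈-concatCells f [] x∈ = x∈
∈-concatCells f (true ∷ σ) x∈ = ∈-++⁺ˡ (∈-concatCells (f ∘ (true ∷_)) σ x∈)
∈-concatCells {N = suc N} f (false ∷ σ) x∈ =
  ∈-++⁺ʳ (concatCells N (f ∘ (true ∷_))) (∈-concatCells (f ∘ (false ∷_)) σ x∈)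

module BoundedAscent (lem : ExcludedMiddle 0ℓ) {Z : Set} (_≼_ : Z → Z → Set)
         (size : Z → ℕ) (B : ℕ) (size≤B : ∀ z → size z ≤ B)
         (size-strict : ∀ {z w} → z ≼ w → ¬ w ≼ z → size z < size w) (Q : Z → Set) where

  Maximal : Z → Set
  Maximal z = Q z × (∀ w → Q w → z ≼ w → w ≼ z)

  private
    ascend : ∀ fuel {z} → B ≤ fuel + size z → Q z → Σ Z Maximal
    ascend fuel {z} B≤ qz with lem {Σ Z λ w → Q w × z ≼ w × ¬ w ≼ z}
    ... | no ∄above =
      z , qz , λ w qw z≼w → decidable-stable lem λ w⋠z → ∄above (w , qw , z≼w , w⋠z)
    ... | yes (w , qw , z≼w , w⋠z) with fuel
    ...   | zero = contradiction (≤-trans (size-strict z≼w w⋠z) (size≤B w)) (≤⇒≯ B≤)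
    ...   | suc fuel = ascend fuel B≤fuel+size[w] qw
      where
      B≤fuel+size[w] : B ≤ fuel + size w
      B≤fuel+size[w] = begin
        B                     ≤⟨ B≤ ⟩
        suc fuel + size z     ≡⟨ +-suc fuel (size z) ⟨
        fuel + suc (size z)   ≤⟨ +-monoʳ-≤ fuel (size-strict z≼w w⋠z) ⟩
        fuel + size w         ∎
        where open ≤-Reasoning

  maximal-exists : ∀ {z} → Q z → Σ Z Maximal
  maximal-exists = ascend B (m≤m+n B _)

-- Back-and-forth in P(I)

module _ (lem : ExcludedMiddle 0ℓ) {I : Set} where

  private
    variable
      A S S′ : I → Set
      a : Subset I
      f t T : ℕ

  truncatedCount : ∀ T (A : I → Set) → Σ ℕ (TruncatedCount T A)
  truncatedCount zero A = 0 , saturatedCount AtLeast-zero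
  truncatedCount (suc T) A with lem {AtLeast A (suc T)}
  ... | yes w = suc T , saturatedCount w
  ... | no ¬w with truncatedCount T A
  ... | t , c = t , record
    { bounded = m≤n⇒m≤1+n (bounded c)
    ; witness = witness c
    ; maximal = λ k≤1+T ak → maximal c (≤-below k≤1+T ak) ak
    }
    where
    ≤-below : ∀ {k} → k ≤ suc T → AtLeast A k → k ≤ T
    ≤-below k≤1+T ak with m≤n⇒m<n∨m≡n k≤1+T
    ... | inj₁ k<1+T = s≤s⁻¹ k<1+T
    ... | inj₂ refl = contradiction ak ¬w

  maximal⇒covers : (w : AtLeast A t) → ¬ AtLeast A (suc t) → A ⊆ (_∈ proj₁ w)
  maximal⇒covers (l , refl , u , al) ¬more {x} ax with lem {x ∈ l}
  ... | yes x∈l = x∈l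
  ... | no x∉l = contradiction (x ∷ l , refl , All.¬Any⇒All¬ l x∉l ∷ u , ax ∷ al) ¬more

  unsaturated⇒covers : (c : TruncatedCount T A t) → t < T → A ⊆ (_∈ elements c)
  unsaturated⇒covers c t<T = maximal⇒covers (witness c) (1+n≰n ∘ maximal c t<T)

  indicator : List I → Subset I
  indicator l i = does (lem {i ∈ l})

  indicator-∈ : ∀ {l i} → i ∈ l → indicator l i ≡ true
  indicator-∈ = dec-true lem

  indicator-∉ : ∀ {l i} → i ∉ l → indicator l i ≡ false
  indicator-∉ = dec-false lem

  indicator≡true⇒∈ : ∀ {l i} → indicator l i ≡ true → i ∈ l
  indicator≡true⇒∈ eq =
    decidable-stable lem λ i∉l → contradiction (trans (sym (indicator-∉ i∉l)) eq) λ ()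

  indicator≡false⇒∉ : ∀ {l i} → indicator l i ≡ false → i ∉ l
  indicator≡false⇒∉ eq i∈l = contradiction (trans (sym (indicator-∈ i∈l)) eq) λ ()

  AtLeast-fibres : TruncatedCount T (S ∩ fibre a true) t → TruncatedCount T (S ∩ fibre a false) f →
                   AtLeast S (t + f)
  AtLeast-fibres {S = S} {a = a} tc fc =
    AtLeast-map [ proj₁ , proj₁ ]′ (AtLeast-++ true≠false (witness tc) (witness fc))
    where
    true≠false : ∀ {x} → (S ∩ fibre a true) x → ¬ (S ∩ fibre a false) x
    true≠false (_ , ax≡true) (_ , ax≡false) = contradiction (trans (sym ax≡true) ax≡false) λ ()

  unsaturated-fibres⇒covers : CountLe (T + T) S′ S →
                 TruncatedCount T (S ∩ fibre a true) t → TruncatedCount T (S ∩ fibre a false) f →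
                 t < T → f < T → (w : AtLeast S′ (t + f)) → S′ ⊆ (_∈ proj₁ w)
  unsaturated-fibres⇒covers {S = S} {a = a} {t = t} {f = f} S′≤S tc fc t<T f<T w =
    maximal⇒covers w λ more →
    1+n≰n (≤-trans (AtLeast⇒≤length S⊆fibres (S′≤S (+-mono-≤ t<T (<⇒≤ f<T)) more))
                   (≤-reflexive |fibres|))
    where
    S⊆fibres : S ⊆ (_∈ elements tc ++ elements fc)
    S⊆fibres {x} sx with a x in ax
    ... | true = ∈-++⁺ˡ (unsaturated⇒covers tc t<T (sx , ax))
    ... | false = ∈-++⁺ʳ (elements tc) (unsaturated⇒covers fc f<T (sx , ax))

    |fibres| : length (elements tc ++ elements fc) ≡ t + f
    |fibres| = trans (length-++ (elements tc)) (cong₂ _+_ (length-elements tc) (length-elements fc))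

  cellTransfer : CountEq (T + T) S S′ → (a : Subset I) →
                 Σ (Subset I) λ a′ → ∀ b → CountEq T (S ∩ fibre a b) (S′ ∩ fibre a′ b)
  cellTransfer {T} {S} {S′} (S≤S′ , S′≤S) a
    with t , tc ← truncatedCount T (S ∩ fibre a true)
       | f , fc ← truncatedCount T (S ∩ fibre a false)
    with L , |L| , uL , L⊆S′ ← S≤S′ (+-mono-≤ (bounded tc) (bounded fc)) (AtLeast-fibres tc fc)
    with P , Q , refl , |P| , |Q| ← split-++ t L |L|
    with uP , uQ , P#Q ← Unique-++⁻ P uL
       | P⊆S′ , Q⊆S′ ← All.++⁻ P L⊆S′
    = choose (f <? T) (t <? T)
    where
    part : ∀ {W n a′ b} → length W ≡ n → Unique W → All S′ W → (∀ {x} → x ∈ W → a′ x ≡ b) →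
           AtLeast (S′ ∩ fibre a′ b) n
    part |W| uW W⊆S′ a′≡b = AtLeast-within (_ , |W| , uW , W⊆S′) λ x∈W x∈S′ → x∈S′ , a′≡b x∈W

    P-marked : CountEq T (S ∩ fibre a true) (S′ ∩ fibre (indicator P) true)
    P-marked = CountEq-by-witness tc (part |P| uP P⊆S′ indicator-∈)
                 (inj₁ (indicator≡true⇒∈ ∘ proj₂))

    ∉P : ∀ {x} → x ∈ Q → x ∉ P
    ∉P x∈Q x∈P = P#Q (x∈P , x∈Q)

    -- Mark P, unless only the true fibre is saturated: then mark the complement of Q. When both
    -- fibres are unsaturated, S′ has exactly t + f elements, so P ∪ Q is all of S′.
    choose : Dec (f < T) → Dec (t < T) →
             Σ (Subset I) λ a′ → ∀ b → CountEq T (S ∩ fibre a b) (S′ ∩ fibre a′ b)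
    choose (no f≮T) _ = indicator P , λ
      { true → P-marked
      ; false → CountEq-by-witness fc (part |Q| uQ Q⊆S′ (indicator-∉ ∘ ∉P))
                  (inj₂ (≤-antisym (bounded fc) (≮⇒≥ f≮T)))
      }
    choose (yes f<T) (yes t<T) = indicator P , λ
      { true → P-marked
      ; false → CountEq-by-witness fc (part |Q| uQ Q⊆S′ (indicator-∉ ∘ ∉P)) (inj₁ Q-covers)
      }
      where
      Q-covers : S′ ∩ fibre (indicator P) false ⊆ (_∈ Q)
      Q-covers (x∈S′ , x∉P)
        with ∈-++⁻ P (unsaturated-fibres⇒covers S′≤S tc fc t<T f<T (L , |L| , uL , L⊆S′) x∈S′)
      ... | inj₁ x∈P = contradiction x∈P (indicator≡false⇒∉ x∉P)
      ... | inj₂ x∈Q = x∈Q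
    choose (yes f<T) (no t≮T) = not ∘ indicator Q , λ
      { true → CountEq-by-witness tc (part |P| uP P⊆S′ (cong not ∘ indicator-∉ ∘ ∉Q))
                 (inj₂ (≤-antisym (bounded tc) (≮⇒≥ t≮T)))
      ; false → CountEq-by-witness fc (part |Q| uQ Q⊆S′ (cong not ∘ indicator-∈))
                  (inj₁ (indicator≡true⇒∈ ∘ not-injective ∘ proj₂))
      }
      where
      ∉Q : ∀ {x} → x ∈ P → x ∉ Q
      ∉Q x∈P x∈Q = P#Q (x∈P , x∈Q)

  extend-EnvEq : ∀ {n} {ρ ρ′ : Fin n → Subset I} → EnvEq (T + T) ρ ρ′ → (a : Subset I) →
                 Σ (Subset I) λ a′ → EnvEq T (extend a ρ) (extend a′ ρ′)
  extend-EnvEq {T} {ρ = ρ} {ρ′} eq a = a′ , λ { (b ∷ σ) →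
    CountEq-resp (Cell-extend a ρ b σ) (≐-trans (on-cell σ b) (Cell-extend a′ ρ′ b σ))
                 (proj₂ (transfer σ) b) }
    where
    transfer : ∀ σ → Σ (Subset I) λ aσ →
               ∀ b → CountEq T (Cell ρ σ ∩ fibre a b) (Cell ρ′ σ ∩ fibre aσ b)
    transfer σ = cellTransfer (eq σ) a

    a′ : Subset I
    a′ i = proj₁ (transfer (cellOf ρ′ i)) i

    a′-on-cell : ∀ {σ x} → Cell ρ′ σ x → a′ x ≡ proj₁ (transfer σ) x
    a′-on-cell {x = x} c = cong (λ τ → proj₁ (transfer τ) x) c

    on-cell : ∀ σ b → Cell ρ′ σ ∩ fibre (proj₁ (transfer σ)) b ≐′ Cell ρ′ σ ∩ fibre a′ b
    on-cell σ b =
      (λ (c , e) → c , trans (a′-on-cell c) e) , (λ (c , e) → c , trans (sym (a′-on-cell c)) e)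

  Sat-invariant : ∀ {n} (φ : Formula n) {ρ ρ′ : Fin n → Subset I} →
                  threshold φ ≤ T → EnvEq T ρ ρ′ → Sat I φ ρ → Sat I φ ρ′
  Sat-invariant (s ≐ t) {ρ} {ρ′} 1≤T eq sat i
    with j , j∼i ← AtLeast-suc⇒∃ (proj₂ (eq (cellOf ρ′ i)) 1≤T (AtLeast-one refl))
    = trans (⟦⟧ₜ-sameCell s (sym j∼i)) (trans (sat j) (⟦⟧ₜ-sameCell t j∼i))
  Sat-invariant (¬ᶠ φ) T≥ eq sat sat′ = sat (Sat-invariant φ T≥ (EnvEq-sym eq) sat′)
  Sat-invariant (φ ∧ᶠ ψ) T≥ eq (satφ , satψ) =
    Sat-invariant φ (m⊔n≤o⇒m≤o _ _ T≥) eq satφ , Sat-invariant ψ (m⊔n≤o⇒n≤o _ _ T≥) eq satψ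
  Sat-invariant (φ ∨ᶠ ψ) T≥ eq (inj₁ satφ) = inj₁ (Sat-invariant φ (m⊔n≤o⇒m≤o _ _ T≥) eq satφ)
  Sat-invariant (φ ∨ᶠ ψ) T≥ eq (inj₂ satψ) = inj₂ (Sat-invariant ψ (m⊔n≤o⇒n≤o _ _ T≥) eq satψ)
  Sat-invariant (φ ⇒ᶠ ψ) T≥ eq sat satφ =
    Sat-invariant ψ (m⊔n≤o⇒n≤o _ _ T≥) eq (sat (Sat-invariant φ (m⊔n≤o⇒m≤o _ _ T≥) (EnvEq-sym eq) satφ))
  Sat-invariant (∀ᶠ φ) {ρ} {ρ′} T≥ eq sat a′
    with a , eq′ ← extend-EnvEq {threshold φ} {ρ = ρ′} {ρ} (EnvEq-sym {ρ = ρ} (EnvEq-≤ T≥ eq)) a′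
    = Sat-invariant φ {extend a ρ} ≤-refl (EnvEq-sym {ρ = extend a′ ρ′} {extend a ρ} eq′) (sat a)
  Sat-invariant (∃ᶠ φ) {ρ} {ρ′} T≥ eq (a , sat)
    with a′ , eq′ ← extend-EnvEq {threshold φ} {ρ = ρ} {ρ′} (EnvEq-≤ T≥ eq) a
    = a′ , Sat-invariant φ {extend a ρ} {extend a′ ρ′} ≤-refl eq′ sat

  module Profile (N T : ℕ) where

    cellCount : (Fin N → Subset I) → Vec Bool N → ℕ
    cellCount ρ σ = proj₁ (truncatedCount T (Cell ρ σ))

    cellCount-spec : ∀ ρ σ → TruncatedCount T (Cell ρ σ) (cellCount ρ σ)
    cellCount-spec ρ σ = proj₂ (truncatedCount T (Cell ρ σ))

    support : (Fin N → Subset I) → List I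
    support ρ = concatCells N λ σ → elements (cellCount-spec ρ σ)

    agree-on-support⇒EnvLe : ∀ {ρ ρ′} → (∀ {i} → i ∈ support ρ → cellOf ρ′ i ≡ cellOf ρ i) →
                             EnvLe T ρ ρ′
    agree-on-support⇒EnvLe {ρ} {ρ′} agree σ k≤T ak =
      AtLeast-≤ (maximal c k≤T ak) (AtLeast-within (witness c) in-ρ′-cell)
      where
      c : TruncatedCount T (Cell ρ σ) (cellCount ρ σ)
      c = cellCount-spec ρ σ
      in-ρ′-cell : ∀ {i} → i ∈ elements c → Cell ρ σ i → Cell ρ′ σ i
      in-ρ′-cell i∈c i-cell = trans (agree (∈-concatCells _ σ i∈c)) i-cell

    EnvLe⇒cellCount≤ : ∀ {ρ ρ′} → EnvLe T ρ ρ′ → ∀ σ → cellCount ρ σ ≤ cellCount ρ′ σ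
    EnvLe⇒cellCount≤ {ρ} {ρ′} le σ = CountLe⇒≤ (cellCount-spec ρ σ) (cellCount-spec ρ′ σ) (le σ)

    size : (Fin N → Subset I) → ℕ
    size ρ = sumCells N (cellCount ρ)

    size≤ : ∀ ρ → size ρ ≤ sumCells N λ _ → T
    size≤ ρ = sumCells-mono N λ σ → bounded (cellCount-spec ρ σ)

    size-strict : ∀ {ρ ρ′} → EnvLe T ρ ρ′ → ¬ EnvLe T ρ′ ρ → size ρ < size ρ′
    size-strict {ρ} {ρ′} le ρ′≰ρ with lem {Σ (Vec Bool N) λ σ → cellCount ρ σ < cellCount ρ′ σ}
    ... | yes (σ , lt) = sumCells-strict (EnvLe⇒cellCount≤ le) σ lt
    ... | no ∄lt = contradiction ge ρ′≰ρ
      where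
      ge : EnvLe T ρ′ ρ
      ge σ = ≤⇒CountLe (cellCount-spec ρ′ σ) (cellCount-spec ρ σ) (≮⇒≥ λ lt → ∄lt (σ , lt))

module Subgroup (G : Group 0ℓ 0ℓ) {I : Set} (H : (I → Group.Carrier G) → Set) (sub : IsSubgroupᴵ G I H)
  where

  open Group G
  open GroupProperties G

  H-resp : ∀ {g h} → (∀ i → g i ≈ h i) → H g → H h
  H-resp = proj₁ sub _ _

  H-ε : H λ _ → ε
  H-ε = proj₁ (proj₂ sub)

  H-∙ : ∀ {g h} → H g → H h → H (λ i → g i ∙ h i)
  H-∙ = proj₁ (proj₂ (proj₂ sub)) _ _

  H-⁻¹ : ∀ {g} → H g → H (λ i → g i ⁻¹)
  H-⁻¹ = proj₂ (proj₂ (proj₂ sub)) _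

  Adherent : (I → Carrier) → Set
  Adherent g = ∀ (F : List I) → Σ (I → Carrier) λ h → H h × (∀ i → i ∈ F → h i ≈ g i)

  adherent-translate : ∀ {u g} → H u → Adherent g → Adherent (λ i → u i ∙ g i)
  adherent-translate {u} Hu adh F with h , Hh , h≈g ← adh F =
    (λ i → u i ∙ h i) , H-∙ Hu Hh , λ i i∈F → ∙-congˡ (h≈g i i∈F)

  translate⁻¹ : ∀ {u g} → H u → H (λ i → u i ∙ g i) → H g
  translate⁻¹ {u} {g} Hu Hug = H-resp (λ i → \\-leftDividesʳ (u i) (g i)) (H-∙ (H-⁻¹ Hu) Hug)

-- Definable subgroups

module DefinableSubgroup (lem : ExcludedMiddle 0ℓ) (G : Group 0ℓ 0ℓ) {I : Set} {m k : ℕ}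
  (c : Vec Bool m → Group.Carrier G) (surj : SurjectiveListing G m c)
  (H : (I → Group.Carrier G) → Set) (sub : IsSubgroupᴵ G I H)
  (φ : Formula (m + k)) (p : Fin k → Subset I)
  (defines : ∀ x → (H (decode G m c x) → Sat I φ (x Vector.++ p)) ×
                   (Sat I φ (x Vector.++ p) → H (decode G m c x)))
  where

  open Group G hiding (refl) renaming (sym to ≈-sym; trans to ≈-trans; reflexive to ≈-reflexive)
  open GroupProperties G
  open Subgroup G H sub
  open Profile lem {I} (m + k) (threshold φ)

  Code : Set
  Code = Fin m → Subset I

  env : Code → Fin (m + k) → Subset I
  env z = z Vector.++ p

  _≼_ : Code → Code → Set
  z ≼ w = EnvLe (threshold φ) (env z) (env w)

  Satisfies : Code → Set
  Satisfies z = Sat I φ (env z)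

  dec : Code → I → Carrier
  dec = decode G m c

  Satisfies⇒H : ∀ {z} → Satisfies z → H (dec z)
  Satisfies⇒H = proj₂ (defines _)

  H⇒Satisfies : ∀ {z h} → H h → (∀ i → dec z i ≈ h i) → Satisfies z
  H⇒Satisfies Hh z≈h = proj₁ (defines _) (H-resp (≈-sym ∘ z≈h) Hh)

  code : (I → Carrier) → Code
  code g j i = lookup (proj₁ (surj (g i))) j

  decode-code : ∀ g i → dec (code g) i ≈ g i
  decode-code g i = ≈-trans (≈-reflexive (cong c (tabulate∘lookup _))) (proj₂ (surj (g i)))

  dec-cong : ∀ z w {i} → (∀ j → z j i ≡ w j i) → dec z i ≡ dec w i
  dec-cong _ _ = cong c ∘ tabulate-cong

  cellOf-env-cong : ∀ {z w i} → (∀ j → z j i ≡ w j i) → cellOf (env z) i ≡ cellOf (env w) i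
  cellOf-env-cong {z} {w} {i} z≡w = tabulate-cong (on-block ∘ splitAt m)
    where
    on-block : ∀ b → [ z , p ]′ b i ≡ [ w , p ]′ b i
    on-block (inj₁ j) = z≡w j
    on-block (inj₂ j) = refl

  patch : List I → Code → Code → Code
  patch F z w j i = if indicator lem F i then z j i else w j i

  patch-∈ : ∀ F z w {i} → i ∈ F → ∀ j → patch F z w j i ≡ z j i
  patch-∈ _ _ _ i∈F j rewrite indicator-∈ lem i∈F = refl

  patch-∉ : ∀ F z w {i} → i ∉ F → ∀ j → patch F z w j i ≡ w j i
  patch-∉ _ _ _ i∉F j rewrite indicator-∉ lem i∉F = refl

  recode-above : ∀ z g → (∀ i → i ∈ support (env z) → g i ≈ dec z i) →
                 Σ Code λ z′ → (∀ i → dec z′ i ≈ g i) × z ≼ z′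
  recode-above z g g≈z = patched , patched≈g ,
    agree-on-support⇒EnvLe λ i∈F → cellOf-env-cong (patch-∈ F z (code g) i∈F)
    where
    F : List I
    F = support (env z)

    patched : Code
    patched = patch F z (code g)

    patched≈g : ∀ i → dec patched i ≈ g i
    patched≈g i = by-membership lem
      where
      by-membership : Dec (i ∈ F) → dec patched i ≈ g i
      by-membership (yes i∈F) =
        ≈-trans (≈-reflexive (dec-cong patched z (patch-∈ F z (code g) i∈F))) (≈-sym (g≈z i i∈F))
      by-membership (no i∉F) =
        ≈-trans (≈-reflexive (dec-cong patched (code g) (patch-∉ F z (code g) i∉F))) (decode-code g i)

  size-strict-code : ∀ {z w} → z ≼ w → ¬ w ≼ z → size (env z) < size (env w)
  size-strict-code = size-strict

  open BoundedAscent lem _≼_ (size ∘ env) _ (size≤ ∘ env) size-strict-code Satisfies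

  maximal-absorbs : ∀ {z y} → Maximal z → Adherent y →
                    (∀ i → i ∈ support (env z) → y i ≈ dec z i) → H y
  maximal-absorbs {z} {y} (sat-z , z-max) y-adh y≈z
    with zy , zy≈y , z≼zy ← recode-above z y y≈z
    with h , Hh , h≈y ← y-adh (support (env zy))
    with z₁ , z₁≈h , zy≼z₁ ← recode-above zy h (λ i i∈ → ≈-trans (h≈y i i∈) (≈-sym (zy≈y i)))
    = H-resp zy≈y (Satisfies⇒H (Sat-invariant lem φ {env z} {env zy} ≤-refl z≈zy sat-z))
    where
    zy≼z : zy ≼ z
    zy≼z = EnvLe-trans zy≼z₁ (z-max z₁ (H⇒Satisfies Hh z₁≈h) (EnvLe-trans z≼zy zy≼z₁))

    z≈zy : EnvEq (threshold φ) (env z) (env zy)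
    z≈zy = EnvLe-antisym z≼zy zy≼z

  closed : ClosedInProduct G I H
  closed g g-adh
    with z , z-maximal ← maximal-exists {code (λ _ → ε)} (H⇒Satisfies H-ε (decode-code _))
    with h , Hh , h≈g ← g-adh (support (env z))
    = translate⁻¹ Hu (maximal-absorbs z-maximal (adherent-translate Hu g-adh) y≈z)
    where
    u : I → Carrier
    u i = dec z i // h i

    Hu : H u
    Hu = H-∙ (Satisfies⇒H (proj₁ z-maximal)) (H-⁻¹ Hh)

    y≈z : ∀ i → i ∈ support (env z) → u i ∙ g i ≈ dec z i
    y≈z i i∈ = ≈-trans (∙-congˡ (≈-sym (h≈g i i∈))) (//-rightDividesˡ (h i) (dec z i))

lemma3p9 : ExcludedMiddle 0ℓ →
    (G : Group 0ℓ 0ℓ) (I : Set) (m : ℕ) (c : Vec Bool m → Group.Carrier G) →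
    SurjectiveListing G m c →
    (H : (I → Group.Carrier G) → Set) →
    IsSubgroupᴵ G I H →
    DefinableWithParams G I m c H →
    ClosedInProduct G I H
lemma3p9 lem G I m c surj H sub (k , φ , p , defines) =
  DefinableSubgroup.closed lem G c surj H sub φ p defines
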